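{- Let $m'\ge1$ be odd. The sum of the pivots over all self twin parsimonious games with $m'+4$ players whose free type representation has an odd number of components (each game counted once) equals $4\cdot 2^{(m'-1)/2}$.
   Context: Parsimonious (P) games: constant-sum homogeneous weighted majority games on $n$ players, without dummies and without dictator, having exactly $n$ minimal winning coalitions (homogeneous: weights $\mathbf w$, quota $q$, $S$ winning iff $\sum_{i\in S}w_i\ge q$, with equality for every minimal winning $S$). Each has a unique minimal homogeneous representation with integer weights $1=w_1\le\dots\le w_n$. Binary representation: $\mathbf b\in\{0,1\}^n$, $b_1=1$, $b_i=1$ iff $w_i>w_{i-1}$. Known: $b_1=1,b_2=0,b_{n-1}=0,b_n=1$ always, and $(b_3,\dots,b_{n-2})$ determines the game, every vector in $\{0,1\}^{n-4}$ arising. The number of types $h$ is the number of distinct weights; the type representation is $(x_1,\dots,x_h)$, $x_t$ the number of players with the $t$-th smallest distinct weight; the free type representation is $(x_1,\dots,x_{h-1})$. A P game is self twin if $b_i=b_{n+1-i}$ for $i=3,\dots,n-2$. When $h-1$ is odd, the middle component $x_{h/2}$ is called the pivot. -}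

module Defs where

open import Data.Bool using (Bool; true; false; if_then_else_; _∧_)
open import Data.Nat using (ℕ; zero; suc; _+_; _∸_; _/_; _%_; _≡ᵇ_)
open import Data.List using (List; []; _∷_; _++_; length; take; drop; reverse)
import Data.List.Properties as LP
import Data.Bool.Properties as BP
open import Data.Vec using (Vec; toList)
import Data.Vec as V
open import Relation.Nullary.Decidable using (⌊_⌋)

-- A parsimonious game on m + 4 players is identified (bijectively, as recalled
-- in the context) with its free middle bits (b_3,...,b_{m+2}) ∈ {0,1}^m.
binRep : {m : ℕ} → Vec Bool m → List Bool
binRep c = true ∷ false ∷ (toList c ++ (false ∷ true ∷ []))

-- type representation from a binary representation (which starts with 1):
-- x_t = length of the t-th block (a 1 followed by its maximal run of 0s),
-- i.e. the number of players sharing the t-th smallest weight.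
runs : ℕ → List Bool → List ℕ
runs k [] = k ∷ []
runs k (true ∷ bs) = k ∷ runs 1 bs
runs k (false ∷ bs) = runs (suc k) bs

typeRepOfBin : List Bool → List ℕ
typeRepOfBin [] = []
typeRepOfBin (true ∷ bs) = runs 1 bs
typeRepOfBin (false ∷ bs) = []   -- never used: b_1 = 1

typeRep : {m : ℕ} → Vec Bool m → List ℕ
typeRep c = typeRepOfBin (binRep c)

freeTypeRep : {m : ℕ} → Vec Bool m → List ℕ
freeTypeRep c = take (length (typeRep c) ∸ 1) (typeRep c)

oddFree : {m : ℕ} → Vec Bool m → Bool
oddFree c = (length (freeTypeRep c) % 2) ≡ᵇ 1

headOr0 : List ℕ → ℕ
headOr0 [] = 0
headOr0 (x ∷ _) = x

-- pivot: the middle component x_{h/2} of the free type representation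
-- (only meaningful when it has an odd number h-1 of components)
pivot : {m : ℕ} → Vec Bool m → ℕ
pivot c = headOr0 (drop (length (freeTypeRep c) / 2) (freeTypeRep c))

-- self twin: b_i = b_{n+1-i} for i = 3..n-2, i.e. the middle bits form a palindrome
selfTwin : {m : ℕ} → Vec Bool m → Bool
selfTwin c = ⌊ LP.≡-dec BP._≟_ (toList c) (reverse (toList c)) ⌋

sumAllVec : (m : ℕ) → (Vec Bool m → ℕ) → ℕ
sumAllVec zero f = f V.[]
sumAllVec (suc m) f = sumAllVec m (λ v → f (false V.∷ v)) + sumAllVec m (λ v → f (true V.∷ v))

pivotSum : ℕ → ℕ
pivotSum m = sumAllVec m (λ c → if selfTwin c ∧ oddFree c then pivot c else 0)

-- Write m′ = 2k + 1.  The middle bits of a self twin game form a palindrome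
-- reverse u ++ a ∷ u with u ∈ {0,1}^k.  The free type representation has one
-- component per 1 among the bits c 0 1, that is 2·#₁(u) + [a = 1] + 1 of them,
-- so their number is odd exactly when a = 0.  The pivot is then the block of
-- equal weights through the central player: the central 0, the zeros on both
-- sides of it and the 1 opening the block, of size 2 + 2·z(u) with z(u) the
-- number of leading zeros of u 0 1.  Finally Σ_u 2 = 2·2^k and Σ_u z(u) = 2^k.
module Submission where

open import Defs
open import Data.Nat using (ℕ; _≤_; _*_; _^_; _∸_; _/_; _%_)
open import Relation.Binary.PropositionalEquality using (_≡_)

open import Data.Bool using (Bool; true; false; if_then_else_; _∧_)
open import Data.List using (List; []; _∷_; _++_; length; take; drop; reverse; [_])
open import Data.List.Properties
  using (length-take; ++-assoc; reverse-++; unfold-reverse; ≡-dec)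
open import Data.Bool.Properties using (_≟_)
open import Data.Nat using (zero; suc; _+_; _<_; _⊓_; _≡ᵇ_; s≤s; z≤n)
open import Data.Nat.DivMod using (m≡m%n+[m/n]*n; m*n/n≡m; m/n<m; m/n≡1+[m∸n]/n)
open import Data.Nat.Properties using (+-suc; +-comm; +-identityʳ; m∸n≤m; m≤n⇒m⊓n≡m)
open import Data.Nat.Tactic.RingSolver using (solve-∀)
open import Data.Vec as Vec using (Vec; toList)
open import Data.Vec.Properties as Vecₚ
  using (toList-++; toList-reverse; toList-injective; cast-is-id; ++-injectiveˡ; reverse-involutive)
open import Function using (_∘_)
open import Relation.Binary.PropositionalEquality using (_≢_; refl; sym; trans; cong; cong₂; subst; module ≡-Reasoning)
open import Relation.Nullary using (Dec)
open import Relation.Nullary.Decidable using (isYes≗does; dec-true; dec-false)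
open ≡-Reasoning

sumAllVec-cong : ∀ m (f g : Vec Bool m → ℕ) → (∀ v → f v ≡ g v) → sumAllVec m f ≡ sumAllVec m g
sumAllVec-cong zero    f g f≗g = f≗g Vec.[]
sumAllVec-cong (suc m) f g f≗g =
  cong₂ _+_ (sumAllVec-cong m _ _ (f≗g ∘ (false Vec.∷_))) (sumAllVec-cong m _ _ (f≗g ∘ (true Vec.∷_)))

sumAllVec-vanishes : ∀ m (f : Vec Bool m → ℕ) → (∀ v → f v ≡ 0) → sumAllVec m f ≡ 0
sumAllVec-vanishes zero    f f≗0 = f≗0 Vec.[]
sumAllVec-vanishes (suc m) f f≗0 =
  cong₂ _+_ (sumAllVec-vanishes m _ (f≗0 ∘ (false Vec.∷_))) (sumAllVec-vanishes m _ (f≗0 ∘ (true Vec.∷_)))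

sumAllVec-+ : ∀ m (f g : Vec Bool m → ℕ) →
              sumAllVec m (λ v → f v + g v) ≡ sumAllVec m f + sumAllVec m g
sumAllVec-+ zero    f g = refl
sumAllVec-+ (suc m) f g = begin
  sumAllVec m (λ v → f₀ v + g₀ v) + sumAllVec m (λ v → f₁ v + g₁ v)
    ≡⟨ cong₂ _+_ (sumAllVec-+ m f₀ g₀) (sumAllVec-+ m f₁ g₁) ⟩
  (sumAllVec m f₀ + sumAllVec m g₀) + (sumAllVec m f₁ + sumAllVec m g₁)
    ≡⟨ interchange (sumAllVec m f₀) (sumAllVec m g₀) (sumAllVec m f₁) (sumAllVec m g₁) ⟩
  (sumAllVec m f₀ + sumAllVec m f₁) + (sumAllVec m g₀ + sumAllVec m g₁) ∎
  where
  f₀ f₁ g₀ g₁ : Vec Bool m → ℕ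
  f₀ = f ∘ (false Vec.∷_)
  f₁ = f ∘ (true Vec.∷_)
  g₀ = g ∘ (false Vec.∷_)
  g₁ = g ∘ (true Vec.∷_)
  interchange : ∀ a b c d → (a + b) + (c + d) ≡ (a + c) + (b + d)
  interchange = solve-∀

sumAllVec-const : ∀ m c → sumAllVec m (λ _ → c) ≡ 2 ^ m * c
sumAllVec-const zero    c = sym (+-identityʳ c)
sumAllVec-const (suc m) c = begin
  sumAllVec m (λ _ → c) + sumAllVec m (λ _ → c) ≡⟨ cong₂ _+_ (sumAllVec-const m c) (sumAllVec-const m c) ⟩
  2 ^ m * c + 2 ^ m * c                         ≡⟨ double (2 ^ m) c ⟩
  2 ^ suc m * c                                 ∎
  where
  double : ∀ p c → p * c + p * c ≡ 2 * p * c
  double = solve-∀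

sumAllVec-++ : ∀ m n (f : Vec Bool (m + n) → ℕ) →
               sumAllVec (m + n) f ≡ sumAllVec m (λ w → sumAllVec n (λ v → f (w Vec.++ v)))
sumAllVec-++ zero    n f = refl
sumAllVec-++ (suc m) n f = cong₂ _+_ (sumAllVec-++ m n _) (sumAllVec-++ m n _)

sumAllVec-swap : ∀ m n (F : Vec Bool m → Vec Bool n → ℕ) →
                 sumAllVec m (λ w → sumAllVec n (F w)) ≡ sumAllVec n (λ v → sumAllVec m (λ w → F w v))
sumAllVec-swap zero    n F = refl
sumAllVec-swap (suc m) n F = begin
  sumAllVec m (λ w → sumAllVec n (F₀ w)) + sumAllVec m (λ w → sumAllVec n (F₁ w))
    ≡⟨ cong₂ _+_ (sumAllVec-swap m n F₀) (sumAllVec-swap m n F₁) ⟩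
  sumAllVec n (λ v → sumAllVec m (λ w → F₀ w v)) + sumAllVec n (λ v → sumAllVec m (λ w → F₁ w v))
    ≡⟨ sumAllVec-+ n _ _ ⟨
  sumAllVec n (λ v → sumAllVec m (λ w → F₀ w v) + sumAllVec m (λ w → F₁ w v)) ∎
  where
  F₀ F₁ : Vec Bool m → Vec Bool n → ℕ
  F₀ = F ∘ (false Vec.∷_)
  F₁ = F ∘ (true Vec.∷_)

sumAllVec-supported : ∀ m (f : Vec Bool m → ℕ) w₀ → (∀ w → w ≢ w₀ → f w ≡ 0) →
                      sumAllVec m f ≡ f w₀
sumAllVec-supported zero f Vec.[] _ = refl
sumAllVec-supported (suc m) f (false Vec.∷ w₀) off = begin
  sumAllVec m (f ∘ (false Vec.∷_)) + sumAllVec m (f ∘ (true Vec.∷_))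
    ≡⟨ cong₂ _+_ (sumAllVec-supported m _ w₀ (λ w w≢w₀ → off _ (w≢w₀ ∘ Vecₚ.∷-injectiveʳ)))
                 (sumAllVec-vanishes m _ (λ w → off _ λ ())) ⟩
  f (false Vec.∷ w₀) + 0 ≡⟨ +-identityʳ _ ⟩
  f (false Vec.∷ w₀)     ∎
sumAllVec-supported (suc m) f (true Vec.∷ w₀) off =
  cong₂ _+_ (sumAllVec-vanishes m _ (λ w → off _ λ ()))
            (sumAllVec-supported m _ w₀ (λ w w≢w₀ → off _ (w≢w₀ ∘ Vecₚ.∷-injectiveʳ)))

sumAllVec-palindromes : ∀ k (f : Vec Bool (k + suc k) → ℕ) →
  (∀ w a u → w ≢ Vec.reverse u → f (w Vec.++ a Vec.∷ u) ≡ 0) →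
  sumAllVec (k + suc k) f ≡ sumAllVec (suc k) (λ v → f (Vec.reverse (Vec.tail v) Vec.++ Vec.head v Vec.∷ Vec.tail v))
sumAllVec-palindromes k f off = begin
  sumAllVec (k + suc k) f
    ≡⟨ sumAllVec-++ k (suc k) f ⟩
  sumAllVec k (λ w → sumAllVec (suc k) (λ v → f (w Vec.++ v)))
    ≡⟨ sumAllVec-swap k (suc k) (λ w v → f (w Vec.++ v)) ⟩
  sumAllVec (suc k) (λ v → sumAllVec k (λ w → f (w Vec.++ v)))
    ≡⟨ cong₂ _+_ (sumAllVec-cong k _ _ (centred false)) (sumAllVec-cong k _ _ (centred true)) ⟩
  sumAllVec (suc k) (λ v → f (Vec.reverse (Vec.tail v) Vec.++ Vec.head v Vec.∷ Vec.tail v)) ∎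
  where
  centred : ∀ a u → sumAllVec k (λ w → f (w Vec.++ a Vec.∷ u)) ≡ f (Vec.reverse u Vec.++ a Vec.∷ u)
  centred a u = sumAllVec-supported k _ (Vec.reverse u) (λ w w≢ → off w a u w≢)

-- typeRep c reduces to runs 2 (toList c ++ endBits): the bits 1 0 of binRep open a block of size 2.
endBits : List Bool
endBits = false ∷ true ∷ []

trues : List Bool → ℕ
trues []           = 0
trues (true ∷ bs)  = suc (trues bs)
trues (false ∷ bs) = trues bs

trues-++ : ∀ bs cs → trues (bs ++ cs) ≡ trues bs + trues cs
trues-++ []           cs = refl
trues-++ (true ∷ bs)  cs = cong suc (trues-++ bs cs)
trues-++ (false ∷ bs) cs = trues-++ bs cs

trues-reverse : ∀ bs → trues (reverse bs) ≡ trues bs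
trues-reverse []       = refl
trues-reverse (b ∷ bs) = begin
  trues (reverse (b ∷ bs))          ≡⟨ cong trues (unfold-reverse b bs) ⟩
  trues (reverse bs ++ [ b ])       ≡⟨ trues-++ (reverse bs) [ b ] ⟩
  trues (reverse bs) + trues [ b ]  ≡⟨ +-comm (trues (reverse bs)) (trues [ b ]) ⟩
  trues [ b ] + trues (reverse bs)  ≡⟨ cong (trues [ b ] +_) (trues-reverse bs) ⟩
  trues [ b ] + trues bs            ≡⟨ trues-++ [ b ] bs ⟨
  trues (b ∷ bs)                    ∎

length-runs : ∀ k bs → length (runs k bs) ≡ suc (trues bs)
length-runs k []           = refl
length-runs k (true ∷ bs)  = cong suc (length-runs 1 bs)
length-runs k (false ∷ bs) = length-runs (suc k) bs

lastRun : ℕ → List Bool → ℕ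
lastRun k []           = k
lastRun k (true ∷ bs)  = lastRun 1 bs
lastRun k (false ∷ bs) = lastRun (suc k) bs

lastRun-++ : ∀ k bs cs → lastRun k (bs ++ cs) ≡ lastRun (lastRun k bs) cs
lastRun-++ k []           cs = refl
lastRun-++ k (true ∷ bs)  cs = lastRun-++ 1 bs cs
lastRun-++ k (false ∷ bs) cs = lastRun-++ (suc k) bs cs

drop-trues-runs : ∀ k bs cs → drop (trues bs) (runs k (bs ++ cs)) ≡ runs (lastRun k bs) cs
drop-trues-runs k []           cs = refl
drop-trues-runs k (true ∷ bs)  cs = drop-trues-runs 1 bs cs
drop-trues-runs k (false ∷ bs) cs = drop-trues-runs (suc k) bs cs

leadingFalses : List Bool → ℕ
leadingFalses []           = 0
leadingFalses (true ∷ bs)  = 0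
leadingFalses (false ∷ bs) = suc (leadingFalses bs)

headOr0-runs : ∀ k bs → headOr0 (runs k bs) ≡ k + leadingFalses bs
headOr0-runs k []           = sym (+-identityʳ k)
headOr0-runs k (true ∷ bs)  = sym (+-identityʳ k)
headOr0-runs k (false ∷ bs) = trans (headOr0-runs (suc k) bs) (sym (+-suc k (leadingFalses bs)))

lastRun-reverse : ∀ bs → lastRun 2 (reverse bs) ≡ suc (leadingFalses (bs ++ endBits))
lastRun-reverse []       = refl
lastRun-reverse (b ∷ bs) = begin
  lastRun 2 (reverse (b ∷ bs))                        ≡⟨ cong (lastRun 2) (unfold-reverse b bs) ⟩
  lastRun 2 (reverse bs ++ [ b ])                     ≡⟨ lastRun-++ 2 (reverse bs) [ b ] ⟩
  lastRun (lastRun 2 (reverse bs)) [ b ]              ≡⟨ cong (λ k → lastRun k [ b ]) (lastRun-reverse bs) ⟩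
  lastRun (suc (leadingFalses (bs ++ endBits))) [ b ] ≡⟨ lastBit b ⟩
  suc (leadingFalses (b ∷ bs ++ endBits))             ∎
  where
  lastBit : ∀ b → lastRun (suc (leadingFalses (bs ++ endBits))) [ b ] ≡ suc (leadingFalses (b ∷ bs ++ endBits))
  lastBit true  = refl
  lastBit false = refl

headOr0-drop-take : ∀ i j (xs : List ℕ) → i < j → headOr0 (drop i (take j xs)) ≡ headOr0 (drop i xs)
headOr0-drop-take zero    (suc j) []       _         = refl
headOr0-drop-take zero    (suc j) (x ∷ xs) _         = refl
headOr0-drop-take (suc i) (suc j) []       _         = refl
headOr0-drop-take (suc i) (suc j) (x ∷ xs) (s≤s i<j) = headOr0-drop-take i j xs i<j

suc[n+n]%2≡1 : ∀ n → suc (n + n) % 2 ≡ 1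
suc[n+n]%2≡1 zero    = refl
suc[n+n]%2≡1 (suc n) = trans (cong (λ m → suc (suc m) % 2) (+-suc n n)) (suc[n+n]%2≡1 n)

[n+n]%2≡0 : ∀ n → (n + n) % 2 ≡ 0
[n+n]%2≡0 zero    = refl
[n+n]%2≡0 (suc n) = trans (cong (λ m → suc m % 2) (+-suc n n)) ([n+n]%2≡0 n)

suc[n+n]/2≡n : ∀ n → suc (n + n) / 2 ≡ n
suc[n+n]/2≡n zero    = refl
suc[n+n]/2≡n (suc n) = begin
  suc (suc n + suc n) / 2     ≡⟨ cong (λ m → suc (suc m) / 2) (+-suc n n) ⟩
  suc (suc (suc (n + n))) / 2 ≡⟨ m/n≡1+[m∸n]/n {m = suc (suc (suc (n + n)))} (s≤s (s≤s z≤n)) ⟩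
  suc (suc (n + n) / 2)       ≡⟨ cong suc (suc[n+n]/2≡n n) ⟩
  suc n                       ∎

reverse-toList-++-∷ : ∀ {A : Set} {m n} (w : Vec A m) a (u : Vec A n) →
  reverse (toList (w Vec.++ a Vec.∷ u)) ≡ toList (Vec.reverse u Vec.++ a Vec.∷ Vec.reverse w)
reverse-toList-++-∷ w a u = begin
  reverse (toList (w Vec.++ a Vec.∷ u))
    ≡⟨ cong reverse (toList-++ w (a Vec.∷ u)) ⟩
  reverse (toList w ++ a ∷ toList u)
    ≡⟨ reverse-++ (toList w) (a ∷ toList u) ⟩
  reverse (a ∷ toList u) ++ reverse (toList w)
    ≡⟨ cong (_++ reverse (toList w)) (unfold-reverse a (toList u)) ⟩
  (reverse (toList u) ++ [ a ]) ++ reverse (toList w)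
    ≡⟨ ++-assoc (reverse (toList u)) [ a ] (reverse (toList w)) ⟩
  reverse (toList u) ++ a ∷ reverse (toList w)
    ≡⟨ cong₂ (λ xs ys → xs ++ a ∷ ys) (toList-reverse u) (toList-reverse w) ⟨
  toList (Vec.reverse u) ++ a ∷ toList (Vec.reverse w)
    ≡⟨ toList-++ (Vec.reverse u) (a Vec.∷ Vec.reverse w) ⟨
  toList (Vec.reverse u Vec.++ a Vec.∷ Vec.reverse w) ∎

palindrome-halves : ∀ {A : Set} {k} (w u : Vec A k) a → let c = w Vec.++ a Vec.∷ u in
                    toList c ≡ reverse (toList c) → w ≡ Vec.reverse u
palindrome-halves w u a pal =
  ++-injectiveˡ w (Vec.reverse u)
    (trans (sym (cast-is-id refl _)) (toList-injective refl _ _ (trans pal (reverse-toList-++-∷ w a u))))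

reverse-++-∷-palindrome : ∀ {A : Set} {k} (u : Vec A k) a → let c = Vec.reverse u Vec.++ a Vec.∷ u in
                          toList c ≡ reverse (toList c)
reverse-++-∷-palindrome u a = sym (begin
  reverse (toList (Vec.reverse u Vec.++ a Vec.∷ u))
    ≡⟨ reverse-toList-++-∷ (Vec.reverse u) a u ⟩
  toList (Vec.reverse u Vec.++ a Vec.∷ Vec.reverse (Vec.reverse u))
    ≡⟨ cong (λ v → toList (Vec.reverse u Vec.++ a Vec.∷ v)) (reverse-involutive u) ⟩
  toList (Vec.reverse u Vec.++ a Vec.∷ u) ∎)

toList-reverse-++-∷ : ∀ {A : Set} {k} (u : Vec A k) a →
                      toList (Vec.reverse u Vec.++ a Vec.∷ u) ≡ reverse (toList u) ++ a ∷ toList u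
toList-reverse-++-∷ u a =
  trans (toList-++ (Vec.reverse u) (a Vec.∷ u)) (cong (_++ a ∷ toList u) (toList-reverse u))

length-typeRep : ∀ {m} (c : Vec Bool m) → length (typeRep c) ≡ suc (suc (trues (toList c)))
length-typeRep c = begin
  length (runs 2 (toList c ++ endBits)) ≡⟨ length-runs 2 (toList c ++ endBits) ⟩
  suc (trues (toList c ++ endBits))     ≡⟨ cong suc (trues-++ (toList c) endBits) ⟩
  suc (trues (toList c) + 1)            ≡⟨ cong suc (+-comm (trues (toList c)) 1) ⟩
  suc (suc (trues (toList c)))          ∎

length-freeTypeRep : ∀ {m} (c : Vec Bool m) → length (freeTypeRep c) ≡ suc (trues (toList c))
length-freeTypeRep c = begin
  length (take (length (typeRep c) ∸ 1) (typeRep c)) ≡⟨ length-take _ (typeRep c) ⟩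
  (length (typeRep c) ∸ 1) ⊓ length (typeRep c)     ≡⟨ m≤n⇒m⊓n≡m (m∸n≤m (length (typeRep c)) 1) ⟩
  length (typeRep c) ∸ 1                             ≡⟨ cong (_∸ 1) (length-typeRep c) ⟩
  suc (trues (toList c))                             ∎

pivot-typeRep : ∀ {m} (c : Vec Bool m) → pivot c ≡ headOr0 (drop (suc (trues (toList c)) / 2) (typeRep c))
pivot-typeRep c = begin
  headOr0 (drop (length (freeTypeRep c) / 2) (freeTypeRep c))
    ≡⟨ cong (λ n → headOr0 (drop (n / 2) (freeTypeRep c))) (length-freeTypeRep c) ⟩
  headOr0 (drop (h / 2) (take (length (typeRep c) ∸ 1) (typeRep c)))
    ≡⟨ headOr0-drop-take (h / 2) _ (typeRep c) (subst (h / 2 <_) (sym h≡) (m/n<m h 2 (s≤s (s≤s z≤n)))) ⟩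
  headOr0 (drop (h / 2) (typeRep c)) ∎
  where
  h : ℕ
  h = suc (trues (toList c))
  h≡ : length (typeRep c) ∸ 1 ≡ h
  h≡ = cong (_∸ 1) (length-typeRep c)

pivotTerm : ∀ {m} → Vec Bool m → ℕ
pivotTerm c = if selfTwin c ∧ oddFree c then pivot c else 0

pivotTerm-offCentre : ∀ {k} (w : Vec Bool k) a u → w ≢ Vec.reverse u → pivotTerm (w Vec.++ a Vec.∷ u) ≡ 0
pivotTerm-offCentre {k} w a u w≢ = cong (λ b → if b ∧ oddFree c then pivot c else 0)
  (trans (isYes≗does palindrome?) (dec-false palindrome? (w≢ ∘ palindrome-halves w u a)))
  where
  c : Vec Bool (k + suc k)
  c = w Vec.++ a Vec.∷ u
  palindrome? : Dec (toList c ≡ reverse (toList c))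
  palindrome? = ≡-dec _≟_ (toList c) (reverse (toList c))

pivotTerm-centred : ∀ {k} (u : Vec Bool k) a → let c = Vec.reverse u Vec.++ a Vec.∷ u in
                    pivotTerm c ≡ (if oddFree c then pivot c else 0)
pivotTerm-centred {k} u a = cong (λ b → if b ∧ oddFree c then pivot c else 0)
  (trans (isYes≗does palindrome?) (dec-true palindrome? (reverse-++-∷-palindrome u a)))
  where
  c : Vec Bool (k + suc k)
  c = Vec.reverse u Vec.++ a Vec.∷ u
  palindrome? : Dec (toList c ≡ reverse (toList c))
  palindrome? = ≡-dec _≟_ (toList c) (reverse (toList c))

trues-centred : ∀ {k} (u : Vec Bool k) a → let t = trues (reverse (toList u)) in
                trues (toList (Vec.reverse u Vec.++ a Vec.∷ u)) ≡ t + (trues [ a ] + t)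
trues-centred u a = begin
  trues (toList (Vec.reverse u Vec.++ a Vec.∷ u)) ≡⟨ cong trues (toList-reverse-++-∷ u a) ⟩
  trues (reverse us ++ a ∷ us)                    ≡⟨ trues-++ (reverse us) (a ∷ us) ⟩
  trues (reverse us) + trues ([ a ] ++ us)        ≡⟨ cong (trues (reverse us) +_) (trues-++ [ a ] us) ⟩
  trues (reverse us) + (trues [ a ] + trues us)
    ≡⟨ cong (λ n → trues (reverse us) + (trues [ a ] + n)) (trues-reverse us) ⟨
  trues (reverse us) + (trues [ a ] + trues (reverse us)) ∎
  where
  us : List Bool
  us = toList u

oddFree-centred : ∀ {k} (u : Vec Bool k) a → let t = trues (reverse (toList u)) in
                  oddFree (Vec.reverse u Vec.++ a Vec.∷ u) ≡ (suc (t + (trues [ a ] + t)) % 2 ≡ᵇ 1)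
oddFree-centred u a = cong (λ n → n % 2 ≡ᵇ 1)
  (trans (length-freeTypeRep (Vec.reverse u Vec.++ a Vec.∷ u)) (cong suc (trues-centred u a)))

pivot-0-centred : ∀ {k} (u : Vec Bool k) → let z = leadingFalses (toList u ++ endBits) in
                  pivot (Vec.reverse u Vec.++ false Vec.∷ u) ≡ 2 + z + z
pivot-0-centred {k} u = begin
  pivot c
    ≡⟨ pivot-typeRep c ⟩
  headOr0 (drop (suc (trues (toList c)) / 2) (runs 2 (toList c ++ endBits)))
    ≡⟨ cong (λ n → headOr0 (drop (suc n / 2) (runs 2 (toList c ++ endBits)))) (trues-centred u false) ⟩
  headOr0 (drop (suc (t + t) / 2) (runs 2 (toList c ++ endBits)))
    ≡⟨ cong₂ (λ i bs → headOr0 (drop i (runs 2 bs))) (suc[n+n]/2≡n t) bits ⟩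
  headOr0 (drop t (runs 2 (reverse us ++ false ∷ us ++ endBits)))
    ≡⟨ cong headOr0 (drop-trues-runs 2 (reverse us) (false ∷ us ++ endBits)) ⟩
  headOr0 (runs (suc (lastRun 2 (reverse us))) (us ++ endBits))
    ≡⟨ headOr0-runs (suc (lastRun 2 (reverse us))) (us ++ endBits) ⟩
  suc (lastRun 2 (reverse us)) + z
    ≡⟨ cong (λ n → suc n + z) (lastRun-reverse us) ⟩
  2 + z + z ∎
  where
  c : Vec Bool (k + suc k)
  c = Vec.reverse u Vec.++ false Vec.∷ u
  us : List Bool
  us = toList u
  t z : ℕ
  t = trues (reverse us)
  z = leadingFalses (us ++ endBits)
  bits : toList c ++ endBits ≡ reverse us ++ false ∷ us ++ endBits
  bits = trans (cong (_++ endBits) (toList-reverse-++-∷ u false)) (++-assoc (reverse us) (false ∷ us) endBits)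

pivotTerm-0-centred : ∀ {k} (u : Vec Bool k) → let z = leadingFalses (toList u ++ endBits) in
                      pivotTerm (Vec.reverse u Vec.++ false Vec.∷ u) ≡ 2 + z + z
pivotTerm-0-centred {k} u = begin
  pivotTerm c                            ≡⟨ pivotTerm-centred u false ⟩
  (if oddFree c then pivot c else 0)     ≡⟨ cong (if_then pivot c else 0) odd ⟩
  pivot c                                ≡⟨ pivot-0-centred u ⟩
  2 + z + z                              ∎
  where
  c : Vec Bool (k + suc k)
  c = Vec.reverse u Vec.++ false Vec.∷ u
  z : ℕ
  z = leadingFalses (toList u ++ endBits)
  odd : oddFree c ≡ true
  odd = trans (oddFree-centred u false) (cong (_≡ᵇ 1) (suc[n+n]%2≡1 (trues (reverse (toList u)))))

pivotTerm-1-centred : ∀ {k} (u : Vec Bool k) → pivotTerm (Vec.reverse u Vec.++ true Vec.∷ u) ≡ 0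
pivotTerm-1-centred {k} u = trans (pivotTerm-centred u true) (cong (if_then pivot c else 0) even)
  where
  c : Vec Bool (k + suc k)
  c = Vec.reverse u Vec.++ true Vec.∷ u
  t : ℕ
  t = trues (reverse (toList u))
  even : oddFree c ≡ false
  even = trans (oddFree-centred u true) (cong (_≡ᵇ 1) (trans (cong (λ n → suc n % 2) (+-suc t t)) ([n+n]%2≡0 t)))

sumAllVec-leadingFalses : ∀ k → sumAllVec k (λ u → leadingFalses (toList u ++ endBits)) ≡ 2 ^ k
sumAllVec-leadingFalses zero    = refl
sumAllVec-leadingFalses (suc k) = begin
  sumAllVec k (λ u → 1 + z u) + sumAllVec k (λ _ → 0)
    ≡⟨ cong₂ _+_ (sumAllVec-+ k (λ _ → 1) z) (sumAllVec-vanishes k _ (λ _ → refl)) ⟩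
  sumAllVec k (λ _ → 1) + sumAllVec k z + 0
    ≡⟨ cong₂ (λ p q → p + q + 0) (sumAllVec-const k 1) (sumAllVec-leadingFalses k) ⟩
  2 ^ k * 1 + 2 ^ k + 0
    ≡⟨ double (2 ^ k) ⟩
  2 ^ suc k ∎
  where
  z : Vec Bool k → ℕ
  z u = leadingFalses (toList u ++ endBits)
  double : ∀ p → p * 1 + p + 0 ≡ 2 * p
  double = solve-∀

pivotSum-odd : ∀ k → pivotSum (k + suc k) ≡ 4 * 2 ^ k
pivotSum-odd k = begin
  pivotSum (k + suc k)
    ≡⟨ sumAllVec-palindromes k pivotTerm pivotTerm-offCentre ⟩
  sumAllVec k (λ u → pivotTerm (Vec.reverse u Vec.++ false Vec.∷ u))
    + sumAllVec k (λ u → pivotTerm (Vec.reverse u Vec.++ true Vec.∷ u))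
    ≡⟨ cong₂ _+_ (sumAllVec-cong k _ _ pivotTerm-0-centred) (sumAllVec-vanishes k _ pivotTerm-1-centred) ⟩
  sumAllVec k (λ u → 2 + z u + z u) + 0
    ≡⟨ cong (_+ 0) (sumAllVec-+ k (λ u → 2 + z u) z) ⟩
  sumAllVec k (λ u → 2 + z u) + sumAllVec k z + 0
    ≡⟨ cong (λ s → s + sumAllVec k z + 0) (sumAllVec-+ k (λ _ → 2) z) ⟩
  sumAllVec k (λ _ → 2) + sumAllVec k z + sumAllVec k z + 0
    ≡⟨ cong₂ (λ p q → p + q + q + 0) (sumAllVec-const k 2) (sumAllVec-leadingFalses k) ⟩
  2 ^ k * 2 + 2 ^ k + 2 ^ k + 0
    ≡⟨ quadruple (2 ^ k) ⟩
  4 * 2 ^ k ∎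
  where
  z : Vec Bool k → ℕ
  z u = leadingFalses (toList u ++ endBits)
  quadruple : ∀ p → p * 2 + p + p + 0 ≡ 4 * p
  quadruple = solve-∀

mainTheorem16 : (m′ : ℕ) → 1 ≤ m′ → m′ % 2 ≡ 1 →
    pivotSum m′ ≡ 4 * 2 ^ ((m′ ∸ 1) / 2)
mainTheorem16 m′ _ m′-odd = begin
  pivotSum m′            ≡⟨ cong pivotSum (trans m′≡1+k*2 (1+k*2≡k+[1+k] k)) ⟩
  pivotSum (k + suc k)   ≡⟨ pivotSum-odd k ⟩
  4 * 2 ^ k              ≡⟨ cong (λ e → 4 * 2 ^ e) k≡[m′∸1]/2 ⟩
  4 * 2 ^ ((m′ ∸ 1) / 2) ∎
  where
  k : ℕ
  k = m′ / 2
  m′≡1+k*2 : m′ ≡ 1 + k * 2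
  m′≡1+k*2 = trans (m≡m%n+[m/n]*n m′ 2) (cong (_+ k * 2) m′-odd)
  1+k*2≡k+[1+k] : ∀ n → 1 + n * 2 ≡ n + (1 + n)
  1+k*2≡k+[1+k] = solve-∀
  k≡[m′∸1]/2 : k ≡ (m′ ∸ 1) / 2
  k≡[m′∸1]/2 = sym (trans (cong (λ n → (n ∸ 1) / 2) m′≡1+k*2) (m*n/n≡m k 2))
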